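{- Let $G=(V,E)$ be a graph, $k\ge 1$, and let $v\in V$ be large-sparse. If $G$ contains a $v$-flower of order $k+1$, then $(G,k)$ is a yes-instance of \textsc{Cliques or Trees Vertex Deletion} if and only if $(G-v,k-1)$ is a yes-instance.
   Context: Graphs are undirected, without self-loops, possibly with multi-edges (a pair of parallel edges forms a cycle). $N(v)$ is the neighbor set; $\rho(v)$ is the number of unordered pairs of neighbors of $v$ that are adjacent (parallel edges counted once). A vertex $v$ is large-sparse if $|N(v)|>7k$ and $\rho(v)\le |N(v)|(|N(v)|-1)/4$. A $v$-flower of order $t$ is a set of $t$ cycles through $v$, no two sharing a vertex other than $v$. \textsc{Cliques or Trees Vertex Deletion}: given $(G,k)$, decide whether there is $X\subseteq V$ with $|X|\le k$ such that every component of $G-X$ is a clique (exactly one edge between any two distinct vertices) or a tree (connected, acyclic). -}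

module Defs where

open import Data.Nat using (ℕ; zero; suc; _+_; _*_; _∸_; _≤_; _<_; _<?_)
open import Data.Fin using (Fin; punchIn; toℕ)
open import Data.Fin.Subset using (Subset; _∈_; _∉_; ∣_∣)
open import Data.List using (List; []; _∷_; _++_; [_]; length; filter; allFin; concatMap; map)
open import Data.List.Membership.Propositional using () renaming (_∈_ to _∈ₗ_)
open import Data.List.Relation.Unary.All using (All)
open import Data.List.Relation.Unary.Linked using (Linked)
open import Data.List.Relation.Unary.Unique.Propositional using (Unique)
open import Data.Vec using (Vec; lookup)
open import Data.Product using (Σ; _×_; _,_; proj₁; proj₂)
open import Data.Sum using (_⊎_)
open import Data.Empty using (⊥)
open import Relation.Nullary using (¬_)
open import Relation.Binary.PropositionalEquality using (_≡_; _≢_)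

-- A finite multigraph on vertex set Fin n: mult u w = number of parallel
-- edges between u and w; symmetric, no self-loops.
record Graph (n : ℕ) : Set where
  field
    mult   : Fin n → Fin n → ℕ
    sym    : ∀ u w → mult u w ≡ mult w u
    noLoop : ∀ u → mult u u ≡ 0
open Graph public

module _ {n : ℕ} (G : Graph n) where

  Adj : Fin n → Fin n → Set
  Adj u w = 1 ≤ mult G u w

  nbrs : Fin n → List (Fin n)
  nbrs v = filter (λ u → 0 <? mult G v u) (allFin n)

  -- ρ(v): number of unordered pairs {u,w} of neighbours of v that are adjacent
  rho : Fin n → ℕ
  rho v = length (filter (λ p → 0 <? mult G (proj₁ p) (proj₂ p))
                   (concatMap (λ u → map (λ w → (u , w))
                                 (filter (λ w → toℕ u <? toℕ w) (nbrs v)))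
                              (nbrs v)))

  LargeSparse : ℕ → Fin n → Set
  LargeSparse k v = (7 * k < length (nbrs v))
                  × (4 * rho v ≤ length (nbrs v) * (length (nbrs v) ∸ 1))

  -- A cycle, given by its cyclic sequence of distinct vertices.
  -- Length 2: a pair of parallel edges.  Length ≥ 3: consecutive (cyclically) adjacent.
  IsCycle : List (Fin n) → Set
  IsCycle [] = ⊥
  IsCycle (a ∷ []) = ⊥
  IsCycle (a ∷ b ∷ []) = Unique (a ∷ b ∷ []) × (2 ≤ mult G a b)
  IsCycle (a ∷ b ∷ c ∷ rest) =
    Unique (a ∷ b ∷ c ∷ rest) × Linked Adj ((a ∷ b ∷ c ∷ rest) ++ [ a ])

  Flower : Fin n → (t : ℕ) → Vec (List (Fin n)) t → Set
  Flower v t cs =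
      (∀ i → IsCycle (lookup cs i) × v ∈ₗ lookup cs i)
    × (∀ i j → i ≢ j → ∀ x → x ∈ₗ lookup cs i → x ∈ₗ lookup cs j → x ≡ v)

  HasFlower : Fin n → ℕ → Set
  HasFlower v t = Σ (Vec (List (Fin n)) t) (Flower v t)

  data Reach (X : Subset n) : Fin n → Fin n → Set where
    here : ∀ {u} → u ∉ X → Reach X u u
    step : ∀ {u x w} → u ∉ X → Adj u x → Reach X x w → Reach X u w

  CompClique : Subset n → Fin n → Set
  CompClique X u = ∀ w₁ w₂ → Reach X u w₁ → Reach X u w₂ → w₁ ≢ w₂ → mult G w₁ w₂ ≡ 1

  -- the component of G - X containing u is a tree: it is connected by
  -- construction; acyclic = no cycle all of whose vertices lie in it
  CompTree : Subset n → Fin n → Set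
  CompTree X u = ∀ (cyc : List (Fin n)) → IsCycle cyc → ¬ All (Reach X u) cyc

  IsSolution : Subset n → Set
  IsSolution X = ∀ u → u ∉ X → CompClique X u ⊎ CompTree X u

  YesInstance : ℕ → Set
  YesInstance k = Σ (Subset n) λ X → (∣ X ∣ ≤ k) × IsSolution X

deleteVertex : ∀ {n} → Graph (suc n) → Fin (suc n) → Graph n
deleteVertex G v = record
  { mult   = λ i j → mult G (punchIn v i) (punchIn v j)
  ; sym    = λ i j → sym G (punchIn v i) (punchIn v j)
  ; noLoop = λ i → noLoop G (punchIn v i)
  }

-- Every solution X with |X| ≤ k contains v. Otherwise, as the petals of the flower share only v,
-- X meets at most |X| ≤ k of the k + 1 petals; a surviving petal is a cycle in the component of v
-- in G − X, which must therefore be a clique. Then the m ≥ |N(v)| − k neighbours of v outside X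
-- are pairwise adjacent, so 2ρ(v) ≥ m(m − 1), and since k < |N(v)|/7 this exceeds the bound
-- 2ρ(v) ≤ |N(v)|(|N(v)| − 1)/2 of sparseness. Solutions of G containing v are exactly the sets
-- X′ ∪ {v} for solutions X′ of G − v, as both leave the same graph after deletion.

module Submission where

open import Defs
open import Data.Nat using (ℕ; zero; suc; _+_; _*_; _∸_; _≤_; _<_; _<?_; z≤n; s≤s)
open import Data.Nat.Properties
open import Data.Nat.Tactic.RingSolver using (solve-∀)
open import Data.Fin as Fin using (Fin; toℕ; punchIn; punchOut)
open import Data.Fin.Properties using (punchIn-injective; punchIn-punchOut; ¬∀⟶∃¬)
open import Data.Fin.Subset using (Subset; _∈_; _∉_; ∣_∣; inside; outside; _-_)
open import Data.Fin.Subset.Properties using (_∈?_; x∈p⇒∣p-x∣<∣p∣; x∈p∧x≢y⇒x∈p-y)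
open import Data.List using (List; []; _∷_; _++_; [_]; length; filter; map; concatMap; tabulate; allFin)
open import Data.List.Properties
  using (filter-reject; filter-all; length-++; length-map; length-tabulate; map-++)
open import Data.List.Membership.Propositional using (find) renaming (_∈_ to _∈ₗ_)
open import Data.List.Membership.Propositional.Properties using (∈-filter⁻)
open import Data.List.Relation.Unary.All as All using (All; []; _∷_)
import Data.List.Relation.Unary.All.Properties as All
open import Data.List.Relation.Unary.Any as Any using (Any)
open import Data.List.Relation.Unary.AllPairs as AllPairs using (AllPairs; []; _∷_)
import Data.List.Relation.Unary.AllPairs.Properties as AllPairs
open import Data.List.Relation.Unary.Linked using (Linked; []; [-]; _∷_)
import Data.List.Relation.Unary.Linked.Properties as Linked
open import Data.List.Relation.Unary.Unique.Propositional using (Unique)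
import Data.List.Relation.Unary.Unique.Propositional.Properties as Unique
open import Data.List.Relation.Binary.Sublist.Propositional using (_⊆_; []; _∷_; _∷ʳ_)
open import Data.List.Relation.Binary.Sublist.Propositional.Properties
  using (++⁺; ++⁺ˡ; map⁺; filter⁺; filter-⊆; length-mono-≤)
open import Data.Vec using (Vec; _∷_; lookup; insertAt; removeAt)
open import Data.Vec.Properties
  using ([]=⇒lookup; lookup⇒[]=; insertAt-lookup; insertAt-punchIn; insertAt-removeAt)
open import Data.Product as Product using (∃-syntax; _×_; _,_; proj₁; proj₂)
open import Data.Sum as Sum using (inj₁; inj₂)
open import Data.Empty using (⊥-elim)
open import Function using (_∘_; id)
open import Function.Bundles using (_⇔_; mk⇔; Equivalence)
open import Relation.Nullary using (¬_; ¬?; Dec; yes; no)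
open import Relation.Binary.PropositionalEquality
  using (_≡_; refl; cong; cong₂; subst; trans; module ≡-Reasoning)
  renaming (sym to ≡-sym)

private
  variable
    n : ℕ
    A B : Set

Unique⇒length≤∣∣ : {X : Subset n} {xs : List (Fin n)} → Unique xs → All (_∈ X) xs → length xs ≤ ∣ X ∣
Unique⇒length≤∣∣ [] [] = z≤n
Unique⇒length≤∣∣ {X = X} {x ∷ xs} (x∉xs ∷ unique) (x∈X ∷ xs⊆X) =
  ≤-trans (s≤s (Unique⇒length≤∣∣ unique xs⊆X-x)) (x∈p⇒∣p-x∣<∣p∣ x∈X)
  where
  xs⊆X-x : All (_∈ X - x) xs
  xs⊆X-x = All.zipWith (λ (x≢y , y∈X) → x∈p∧x≢y⇒x∈p-y y∈X (x≢y ∘ ≡-sym)) (x∉xs , xs⊆X)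

∣insertAt-inside∣ : (X : Subset n) (i : Fin (suc n)) → ∣ insertAt X i inside ∣ ≡ suc ∣ X ∣
∣insertAt-inside∣ X Fin.zero = refl
∣insertAt-inside∣ (inside ∷ X) (Fin.suc i) = cong suc (∣insertAt-inside∣ X i)
∣insertAt-inside∣ (outside ∷ X) (Fin.suc i) = ∣insertAt-inside∣ X i

length-filter-∁ : ∀ {P : A → Set} (P? : (x : A) → Dec (P x)) xs →
                  length xs ≡ length (filter P? xs) + length (filter (¬? ∘ P?) xs)
length-filter-∁ P? [] = refl
length-filter-∁ P? (x ∷ xs) with P? x
... | yes _ = cong suc (length-filter-∁ P? xs)
... | no _ = trans (cong suc (length-filter-∁ P? xs)) (≡-sym (+-suc _ _))

-- Pairs (u , w) with u < w, so that rho G v unfolds to the number of adjacent pairs in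
-- orderedPairs (nbrs G v) (nbrs G v).

pairsFrom : Fin n → List (Fin n) → List (Fin n × Fin n)
pairsFrom u ws = map (u ,_) (filter (λ w → toℕ u <? toℕ w) ws)

orderedPairs : List (Fin n) → List (Fin n) → List (Fin n × Fin n)
orderedPairs us ws = concatMap (λ u → pairsFrom u ws) us

orderedPairs-mono : {us us′ ws ws′ : List (Fin n)} →
                    us ⊆ us′ → ws ⊆ ws′ → orderedPairs us ws ⊆ orderedPairs us′ ws′
orderedPairs-mono [] _ = []
orderedPairs-mono {ws′ = ws′} (u ∷ʳ us⊆us′) ws⊆ws′ =
  ++⁺ˡ (pairsFrom u ws′) (orderedPairs-mono us⊆us′ ws⊆ws′)
orderedPairs-mono (refl ∷ us⊆us′) ws⊆ws′ =
  ++⁺ (map⁺ _ (filter⁺ _ _ (λ { refl u<w → u<w }) ws⊆ws′)) (orderedPairs-mono us⊆us′ ws⊆ws′)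

All-orderedPairs : ∀ {P : Fin n × Fin n → Set} us ws →
                   (∀ {u w} → u ∈ₗ us → w ∈ₗ ws → toℕ u < toℕ w → P (u , w)) → All P (orderedPairs us ws)
All-orderedPairs [] ws P-pairs = []
All-orderedPairs {P = P} (u ∷ us) ws P-pairs =
  All.++⁺ (All.map⁺ (All.tabulate P-from-u)) (All-orderedPairs us ws (P-pairs ∘ Any.there))
  where
  P-from-u : ∀ {w} → w ∈ₗ filter (λ w → toℕ u <? toℕ w) ws → P (u , w)
  P-from-u w∈ = let w∈ws , u<w = ∈-filter⁻ (λ w → toℕ u <? toℕ w) {xs = ws} w∈ in
                P-pairs (Any.here refl) w∈ws u<w

orderedPairs-skip : ∀ {a : Fin n} us ws →
                    All (λ u → toℕ a < toℕ u) us → orderedPairs us (a ∷ ws) ≡ orderedPairs us ws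
orderedPairs-skip [] ws [] = refl
orderedPairs-skip (u ∷ us) ws (a<u ∷ a<us) =
  cong₂ _++_ (cong (map (u ,_)) (filter-reject (λ w → toℕ u <? toℕ w) (<-asym a<u)))
             (orderedPairs-skip us ws a<us)

length-orderedPairs : (us : List (Fin n)) → AllPairs Fin._<_ us →
                      2 * length (orderedPairs us us) ≡ length us * (length us ∸ 1)
length-orderedPairs [] [] = refl
length-orderedPairs (a ∷ as) (a<as ∷ sorted) = begin
  2 * length (pairsFrom a (a ∷ as) ++ orderedPairs as (a ∷ as))
    ≡⟨ cong (2 *_) (length-++ (pairsFrom a (a ∷ as))) ⟩
  2 * (length (pairsFrom a (a ∷ as)) + length (orderedPairs as (a ∷ as)))
    ≡⟨ cong₂ (λ p q → 2 * (p + length q)) length-pairsFrom (orderedPairs-skip as as a<as) ⟩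
  2 * (length as + length (orderedPairs as as))
    ≡⟨ *-distribˡ-+ 2 (length as) _ ⟩
  2 * length as + 2 * length (orderedPairs as as)
    ≡⟨ cong (2 * length as +_) (length-orderedPairs as sorted) ⟩
  2 * length as + length as * (length as ∸ 1)
    ≡⟨ triangular (length as) ⟩
  suc (length as) * length as ∎
  where
  open ≡-Reasoning
  length-pairsFrom : length (pairsFrom a (a ∷ as)) ≡ length as
  length-pairsFrom = begin
    length (pairsFrom a (a ∷ as))  ≡⟨ length-map (a ,_) (filter a<? (a ∷ as)) ⟩
    length (filter a<? (a ∷ as))   ≡⟨ cong length (filter-reject a<? (<-irrefl refl)) ⟩
    length (filter a<? as)         ≡⟨ cong length (filter-all a<? a<as) ⟩
    length as ∎
    where
    a<? : ∀ w → Dec (toℕ a < toℕ w)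
    a<? w = toℕ a <? toℕ w
  triangular : ∀ l → 2 * l + l * (l ∸ 1) ≡ suc l * l
  triangular zero = refl
  triangular (suc l) = identity l
    where
    identity : ∀ l → 2 * suc l + suc l * l ≡ suc (suc l) * suc l
    identity = solve-∀

sparse-arith : ∀ {k d m} → 1 ≤ k → 7 * k < d → d ≤ m + k → d * (d ∸ 1) < 2 * (m * (m ∸ 1))
sparse-arith {zero} () _ _
sparse-arith {k@(suc j)} {d} {m} _ 7k<d d≤m+k with m≤n⇒∃[o]m+o≡n 7k<d
... | r , refl = begin-strict
  suc (7 * k + r) * (7 * k + r)          <⟨ m<m+n _ (s≤s z≤n) ⟩
  suc (7 * k + r) * (7 * k + r) + gap    ≡⟨ expand j r ⟨
  2 * (suc (6 * k + r) * (6 * k + r))    ≤⟨ *-monoʳ-≤ 2 (*-mono-≤ m₀≤m (∸-monoˡ-≤ 1 m₀≤m)) ⟩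
  2 * (m * (m ∸ 1))                      ∎
  where
  open ≤-Reasoning
  -- Since k = suc j, gap normalises to a successor, which gives the strict step above.
  gap : ℕ
  gap = 23 * k * k + 10 * k * r + r * r + 5 * k + r
  expand : ∀ j r → let k = suc j in
           2 * (suc (6 * k + r) * (6 * k + r))
         ≡ suc (7 * k + r) * (7 * k + r) + (23 * k * k + 10 * k * r + r * r + 5 * k + r)
  expand = solve-∀
  m₀≤m : suc (6 * k + r) ≤ m
  m₀≤m = +-cancelʳ-≤ k _ _ (subst (_≤ m + k) (split j r) d≤m+k)
    where
    split : ∀ j r → let k = suc j in suc (7 * k + r) ≡ suc (6 * k + r) + k
    split = solve-∀

Linked-++⁻ˡ : ∀ {R : A → A → Set} xs {ys} → Linked R (xs ++ ys) → Linked R xs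
Linked-++⁻ˡ [] _ = []
Linked-++⁻ˡ (x ∷ []) _ = [-]
Linked-++⁻ˡ (x ∷ y ∷ xs) (Rxy ∷ linked) = Rxy ∷ Linked-++⁻ˡ (y ∷ xs) linked

Adj-sym : (G : Graph n) {u w : Fin n} → Adj G u w → Adj G w u
Adj-sym G {u} {w} = subst (1 ≤_) (Graph.sym G u w)

IsCycle⇒Linked : (G : Graph n) (c : List (Fin n)) → IsCycle G c → Linked (Adj G) c
IsCycle⇒Linked G (a ∷ b ∷ []) (_ , 2≤mult) = ≤-trans (s≤s z≤n) 2≤mult ∷ [-]
IsCycle⇒Linked G c@(a ∷ b ∷ _ ∷ _) (_ , linked) = Linked-++⁻ˡ c linked

module _ (G : Graph n) (X : Subset n) where

  Reach-source∉ : ∀ {u w} → Reach G X u w → u ∉ X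
  Reach-source∉ (here u∉X) = u∉X
  Reach-source∉ (step u∉X _ _) = u∉X

  Reach-trans : ∀ {u w x} → Reach G X u w → Reach G X w x → Reach G X u x
  Reach-trans (here _) r = r
  Reach-trans (step u∉X adj r) r′ = step u∉X adj (Reach-trans r r′)

  Reach-sym : ∀ {u w} → Reach G X u w → Reach G X w u
  Reach-sym (here u∉X) = here u∉X
  Reach-sym (step u∉X adj r) = Reach-trans (Reach-sym r) (step (Reach-source∉ r) (Adj-sym G adj) (here u∉X))

  Linked⇒Reach : ∀ {a xs} → Linked (Adj G) (a ∷ xs) → All (_∉ X) (a ∷ xs) → All (Reach G X a) (a ∷ xs)
  Linked⇒Reach {xs = []} _ (a∉X ∷ []) = here a∉X ∷ []
  Linked⇒Reach {xs = _ ∷ _} (adj ∷ linked) (a∉X ∷ avoid) =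
    here a∉X ∷ All.map (step a∉X adj) (Linked⇒Reach linked avoid)

  cycle⊆component : ∀ {u c} → IsCycle G c → All (_∉ X) c → u ∈ₗ c → All (Reach G X u) c
  cycle⊆component {c = c@(a ∷ _)} cycle avoid u∈c =
    All.map (Reach-trans (Reach-sym (All.lookup reach u∈c))) reach
    where
    reach : All (Reach G X a) c
    reach = Linked⇒Reach (IsCycle⇒Linked G _ cycle) avoid

module _ {G : Graph n} {X : Subset n} {v : Fin n} {t : ℕ} {cs : Vec (List (Fin n)) t} where

  flower-order≤∣hitting-set∣ : v ∉ X → Flower G v t cs → (∀ i → Any (_∈ X) (lookup cs i)) → t ≤ ∣ X ∣
  flower-order≤∣hitting-set∣ v∉X (_ , disjoint) hits =
    subst (_≤ ∣ X ∣) (length-tabulate hit)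
          (Unique⇒length≤∣∣ (Unique.tabulate⁺ hit-injective) (All.tabulate⁺ hit∈X))
    where
    hit : Fin t → Fin n
    hit i = proj₁ (find (hits i))
    hit∈petal : ∀ i → hit i ∈ₗ lookup cs i
    hit∈petal i = proj₁ (proj₂ (find (hits i)))
    hit∈X : ∀ i → hit i ∈ X
    hit∈X i = proj₂ (proj₂ (find (hits i)))
    hit-injective : ∀ {i j} → hit i ≡ hit j → i ≡ j
    hit-injective {i} {j} hitᵢ≡hitⱼ with i Fin.≟ j
    ... | yes i≡j = i≡j
    ... | no i≢j = ⊥-elim (v∉X (subst (_∈ X) hitᵢ≡v (hit∈X i)))
      where
      hitᵢ≡v : hit i ≡ v
      hitᵢ≡v = disjoint i j i≢j (hit i) (hit∈petal i)
                        (subst (_∈ₗ lookup cs j) (≡-sym hitᵢ≡hitⱼ) (hit∈petal j))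

  flower⇒petal-avoiding : v ∉ X → ∣ X ∣ < t → Flower G v t cs → ∃[ i ] All (_∉ X) (lookup cs i)
  flower⇒petal-avoiding v∉X ∣X∣<t flower
    with ¬∀⟶∃¬ t _ (λ i → Any.any? (_∈? X) (lookup cs i))
                   (<⇒≱ ∣X∣<t ∘ flower-order≤∣hitting-set∣ v∉X flower)
  ... | i , ¬hit = i , All.¬Any⇒All¬ _ ¬hit

flower⇒¬CompTree : {G : Graph n} {X : Subset n} {v : Fin n} {t : ℕ} →
                   v ∉ X → ∣ X ∣ < t → HasFlower G v t → ¬ CompTree G X v
flower⇒¬CompTree {G = G} {X} {v} v∉X ∣X∣<t (cs , flower) tree
  with flower⇒petal-avoiding {cs = cs} v∉X ∣X∣<t flower
... | i , avoid = tree (lookup cs i) cycle (cycle⊆component G X cycle avoid v∈petal)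
  where
  cycle : IsCycle G (lookup cs i)
  cycle = proj₁ (proj₁ flower i)
  v∈petal : v ∈ₗ lookup cs i
  v∈petal = proj₂ (proj₁ flower i)

∈-nbrs⇒Adj : (G : Graph n) {u v : Fin n} → u ∈ₗ nbrs G v → Adj G v u
∈-nbrs⇒Adj {n} G {v = v} u∈N = proj₂ (∈-filter⁻ (λ u → 0 <? mult G v u) {xs = allFin n} u∈N)

nbrsOutside : Graph n → Subset n → Fin n → List (Fin n)
nbrsOutside G X v = filter (λ u → ¬? (u ∈? X)) (nbrs G v)

module _ (G : Graph n) (X : Subset n) (v : Fin n) where

  private
    N N∖X : List (Fin n)
    N = nbrs G v
    N∖X = nbrsOutside G X v
    adjacent? : (p : Fin n × Fin n) → Dec (0 < mult G (proj₁ p) (proj₂ p))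
    adjacent? (u , w) = 0 <? mult G u w

  length-nbrs≤ : ∀ {k} → ∣ X ∣ ≤ k → length N ≤ length N∖X + k
  length-nbrs≤ {k} ∣X∣≤k = begin
    length N                                    ≡⟨ length-filter-∁ (_∈? X) N ⟩
    length (filter (_∈? X) N) + length N∖X      ≤⟨ +-monoˡ-≤ (length N∖X) (≤-trans N∩X≤∣X∣ ∣X∣≤k) ⟩
    k + length N∖X                              ≡⟨ +-comm k (length N∖X) ⟩
    length N∖X + k                              ∎
    where
    open ≤-Reasoning
    N∩X≤∣X∣ : length (filter (_∈? X) N) ≤ ∣ X ∣
    N∩X≤∣X∣ = Unique⇒length≤∣∣ (Unique.filter⁺ _ (Unique.filter⁺ _ (Unique.allFin⁺ n)))
                               (All.all-filter (_∈? X) N)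

  CompClique⇒rho≥ : v ∉ X → CompClique G X v → length N∖X * (length N∖X ∸ 1) ≤ 2 * rho G v
  CompClique⇒rho≥ v∉X clique = begin
    length N∖X * (length N∖X ∸ 1)        ≡⟨ length-orderedPairs N∖X sorted ⟨
    2 * length (orderedPairs N∖X N∖X)    ≤⟨ *-monoʳ-≤ 2 pairs≤rho ⟩
    2 * rho G v                          ∎
    where
    open ≤-Reasoning
    sorted : AllPairs Fin._<_ N∖X
    sorted = AllPairs.filter⁺ _ (AllPairs.filter⁺ _ (AllPairs.tabulate⁺-< id))
    N∖X⊆N : N∖X ⊆ N
    N∖X⊆N = filter-⊆ _ N
    reach : ∀ {u} → u ∈ₗ N∖X → Reach G X v u
    reach u∈N∖X = let u∈N , u∉X = ∈-filter⁻ (λ u → ¬? (u ∈? X)) {xs = N} u∈N∖X in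
                  step v∉X (∈-nbrs⇒Adj G u∈N) (here u∉X)
    adjacent : All (λ p → 0 < mult G (proj₁ p) (proj₂ p)) (orderedPairs N∖X N∖X)
    adjacent = All-orderedPairs N∖X N∖X λ u∈ w∈ u<w →
      subst (0 <_) (≡-sym (clique _ _ (reach u∈) (reach w∈) (λ { refl → <-irrefl refl u<w }))) (s≤s z≤n)
    N∖X-pairs⊆N-pairs : orderedPairs N∖X N∖X ⊆ orderedPairs N N
    N∖X-pairs⊆N-pairs = orderedPairs-mono N∖X⊆N N∖X⊆N
    pairs≤rho : length (orderedPairs N∖X N∖X) ≤ rho G v
    pairs≤rho = begin
      length (orderedPairs N∖X N∖X)
        ≡⟨ cong length (filter-all adjacent? adjacent) ⟨
      length (filter adjacent? (orderedPairs N∖X N∖X))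
        ≤⟨ length-mono-≤ (filter⁺ _ _ (λ { refl → id }) N∖X-pairs⊆N-pairs) ⟩
      length (filter adjacent? (orderedPairs N N))
        ≡⟨⟩
      rho G v ∎

large-sparse⇒¬CompClique : {G : Graph n} {X : Subset n} {v : Fin n} {k : ℕ} →
                           1 ≤ k → LargeSparse G k v → ∣ X ∣ ≤ k → v ∉ X → ¬ CompClique G X v
large-sparse⇒¬CompClique {G = G} {X} {v} 1≤k (7k<d , 4ρ≤d[d-1]) ∣X∣≤k v∉X clique =
  <⇒≱ (sparse-arith 1≤k 7k<d (length-nbrs≤ G X v ∣X∣≤k)) (begin
    2 * (m * (m ∸ 1))    ≤⟨ *-monoʳ-≤ 2 (CompClique⇒rho≥ G X v v∉X clique) ⟩
    2 * (2 * rho G v)    ≡⟨ *-assoc 2 2 (rho G v) ⟨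
    4 * rho G v          ≤⟨ 4ρ≤d[d-1] ⟩
    d * (d ∸ 1)          ∎)
  where
  open ≤-Reasoning
  d m : ℕ
  d = length (nbrs G v)
  m = length (nbrsOutside G X v)

large-sparse-flower-center∈solution :
  {G : Graph n} {X : Subset n} {v : Fin n} {k : ℕ} → 1 ≤ k → LargeSparse G k v → HasFlower G v (suc k) →
  IsSolution G X → ∣ X ∣ ≤ k → v ∈ X
large-sparse-flower-center∈solution {X = X} {v} 1≤k sparse flower solution ∣X∣≤k with v ∈? X
... | yes v∈X = v∈X
... | no v∉X with solution v v∉X
...   | inj₁ clique = ⊥-elim (large-sparse⇒¬CompClique 1≤k sparse ∣X∣≤k v∉X clique)
...   | inj₂ tree = ⊥-elim (flower⇒¬CompTree v∉X (s≤s ∣X∣≤k) flower tree)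

All-preimage : ∀ {P : A → Set} (f : A → B) (xs : List B) →
               All (λ x → ∃[ y ] f y ≡ x × P y) xs → ∃[ ys ] map f ys ≡ xs × All P ys
All-preimage f [] [] = [] , refl , []
All-preimage f (_ ∷ xs) ((y , refl , py) ∷ pxs) with All-preimage f xs pxs
... | ys , refl , pys = y ∷ ys , refl , py ∷ pys

module _ (G : Graph (suc n)) (v : Fin (suc n)) (X′ : Subset n) where

  private
    G′ : Graph n
    G′ = deleteVertex G v
    X : Subset (suc n)
    X = insertAt X′ v inside

  punchIn∈⇒∈ : ∀ {u} → punchIn v u ∈ X → u ∈ X′
  punchIn∈⇒∈ {u} u∈X = lookup⇒[]= u X′ (trans (≡-sym (insertAt-punchIn X′ v inside u)) ([]=⇒lookup u∈X))

  ∈⇒punchIn∈ : ∀ {u} → u ∈ X′ → punchIn v u ∈ X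
  ∈⇒punchIn∈ {u} u∈X′ = lookup⇒[]= (punchIn v u) X (trans (insertAt-punchIn X′ v inside u) ([]=⇒lookup u∈X′))

  ∉⇒punchIn : ∀ {u} → u ∉ X → ∃[ u′ ] punchIn v u′ ≡ u
  ∉⇒punchIn {u} u∉X with v Fin.≟ u
  ... | yes refl = ⊥-elim (u∉X (lookup⇒[]= v X (insertAt-lookup X′ v inside)))
  ... | no v≢u = punchOut v≢u , punchIn-punchOut v≢u

  Reach-punchIn⁺ : ∀ {u w} → Reach G′ X′ u w → Reach G X (punchIn v u) (punchIn v w)
  Reach-punchIn⁺ (here u∉X′) = here (u∉X′ ∘ punchIn∈⇒∈)
  Reach-punchIn⁺ (step u∉X′ adj r) = step (u∉X′ ∘ punchIn∈⇒∈) adj (Reach-punchIn⁺ r)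

  Reach-punchIn⁻ : ∀ {u w} → Reach G X (punchIn v u) w → ∃[ w′ ] punchIn v w′ ≡ w × Reach G′ X′ u w′
  Reach-punchIn⁻ (here u∉X) = _ , refl , here (u∉X ∘ ∈⇒punchIn∈)
  Reach-punchIn⁻ (step u∉X adj r) with ∉⇒punchIn (Reach-source∉ G X r)
  ... | x′ , refl = let w′ , w′↦w , r′ = Reach-punchIn⁻ r in w′ , w′↦w , step (u∉X ∘ ∈⇒punchIn∈) adj r′

  IsCycle-punchIn : ∀ c → IsCycle G′ c ⇔ IsCycle G (map (punchIn v) c)
  IsCycle-punchIn [] = mk⇔ id id
  IsCycle-punchIn (a ∷ []) = mk⇔ id id
  IsCycle-punchIn (a ∷ b ∷ []) =
    mk⇔ (Product.map₁ (Unique.map⁺ (punchIn-injective v _ _))) (Product.map₁ Unique.map⁻)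
  IsCycle-punchIn c@(a ∷ b ∷ _ ∷ _) = mk⇔
    (λ (unique , linked) → Unique.map⁺ (punchIn-injective v _ _) unique ,
       subst (Linked (Adj G)) (map-++ (punchIn v) c [ a ]) (Linked.map⁺ linked))
    (λ (unique , linked) → Unique.map⁻ unique ,
       Linked.map⁻ {R = Adj G} (subst (Linked (Adj G)) (≡-sym (map-++ (punchIn v) c [ a ])) linked))

  CompClique-punchIn : ∀ u → CompClique G′ X′ u ⇔ CompClique G X (punchIn v u)
  CompClique-punchIn u = mk⇔ to from
    where
    to : CompClique G′ X′ u → CompClique G X (punchIn v u)
    to clique w₁ w₂ r₁ r₂ w₁≢w₂ with Reach-punchIn⁻ r₁ | Reach-punchIn⁻ r₂
    ... | w₁′ , refl , r₁′ | w₂′ , refl , r₂′ = clique w₁′ w₂′ r₁′ r₂′ (w₁≢w₂ ∘ cong (punchIn v))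
    from : CompClique G X (punchIn v u) → CompClique G′ X′ u
    from clique w₁ w₂ r₁ r₂ w₁≢w₂ =
      clique _ _ (Reach-punchIn⁺ r₁) (Reach-punchIn⁺ r₂) (w₁≢w₂ ∘ punchIn-injective v _ _)

  CompTree-punchIn : ∀ u → CompTree G′ X′ u ⇔ CompTree G X (punchIn v u)
  CompTree-punchIn u = mk⇔ to from
    where
    to : CompTree G′ X′ u → CompTree G X (punchIn v u)
    to tree c cycle reach with All-preimage (punchIn v) c (All.map Reach-punchIn⁻ reach)
    ... | c′ , refl , reach′ = tree c′ (Equivalence.from (IsCycle-punchIn c′) cycle) reach′
    from : CompTree G X (punchIn v u) → CompTree G′ X′ u
    from tree c′ cycle′ reach′ =
      tree (map (punchIn v) c′) (Equivalence.to (IsCycle-punchIn c′) cycle′)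
           (All.map⁺ (All.map Reach-punchIn⁺ reach′))

  IsSolution-punchIn : IsSolution G′ X′ ⇔ IsSolution G X
  IsSolution-punchIn = mk⇔ to from
    where
    to : IsSolution G′ X′ → IsSolution G X
    to solution u u∉X with ∉⇒punchIn u∉X
    ... | u′ , refl = Sum.map (Equivalence.to (CompClique-punchIn u′)) (Equivalence.to (CompTree-punchIn u′))
                              (solution u′ (u∉X ∘ ∈⇒punchIn∈))
    from : IsSolution G X → IsSolution G′ X′
    from solution u′ u′∉X′ =
      Sum.map (Equivalence.from (CompClique-punchIn u′)) (Equivalence.from (CompTree-punchIn u′))
              (solution (punchIn v u′) (u′∉X′ ∘ punchIn∈⇒∈))

insertAt-removeAt-∈ : {X : Subset (suc n)} {v : Fin (suc n)} → v ∈ X → insertAt (removeAt X v) v inside ≡ X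
insertAt-removeAt-∈ {X = X} {v} v∈X =
  trans (cong (insertAt (removeAt X v) v) (≡-sym ([]=⇒lookup v∈X))) (insertAt-removeAt X v)

lemma8 : ∀ {n : ℕ} (G : Graph (suc n)) (k : ℕ) (v : Fin (suc n))
       → 1 ≤ k → LargeSparse G k v → HasFlower G v (suc k)
       → YesInstance G k ⇔ YesInstance (deleteVertex G v) (k ∸ 1)
lemma8 G zero v () _ _
lemma8 G (suc k) v 1≤k sparse flower = mk⇔ delete restore
  where
  delete : YesInstance G (suc k) → YesInstance (deleteVertex G v) k
  delete (X , ∣X∣≤k , solution) =
    removeAt X v , ≤-pred (subst (_≤ suc k) ∣X∣≡ ∣X∣≤k) ,
    Equivalence.from (IsSolution-punchIn G v (removeAt X v)) (subst (IsSolution G) (≡-sym X≡) solution)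
    where
    X≡ : insertAt (removeAt X v) v inside ≡ X
    X≡ = insertAt-removeAt-∈ (large-sparse-flower-center∈solution 1≤k sparse flower solution ∣X∣≤k)
    ∣X∣≡ : ∣ X ∣ ≡ suc ∣ removeAt X v ∣
    ∣X∣≡ = trans (cong ∣_∣ (≡-sym X≡)) (∣insertAt-inside∣ (removeAt X v) v)
  restore : YesInstance (deleteVertex G v) k → YesInstance G (suc k)
  restore (X′ , ∣X′∣≤k , solution′) =
    insertAt X′ v inside , subst (_≤ suc k) (≡-sym (∣insertAt-inside∣ X′ v)) (s≤s ∣X′∣≤k) ,
    Equivalence.to (IsSolution-punchIn G v X′) solution′
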